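{- For integers $M\ge1$ and $0\le s\le M$, \[ \sum_{r=0}^{M-s}(-1)^{r-M+s}(M+1)^r\binom{r+s}{s}\left[{M+1\atop r+s+1}\right]=\left[{M+1\atop s+1}\right]. \] Equivalently, \[ \sum_{j=0}^{M}(-1)^{j}(M+1)^j\binom{j}{s}\left[{M+1\atop j+1}\right]=(-1)^M(M+1)^s\left[{M+1\atop s+1}\right]. \]
   Context: $\left[{n\atop k}\right]$ denotes the Stirling cycle number (unsigned Stirling number of the first kind), the number of permutations of an $n$-element set with exactly $k$ cycles. -}

module Defs where

open import Data.Nat using (ℕ; zero; suc; _+_; _*_)
open import Data.Integer as ℤ using (ℤ)

stirling1 : ℕ → ℕ → ℕ
stirling1 zero    zero    = 1
stirling1 zero    (suc k) = 0
stirling1 (suc n) zero    = 0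
stirling1 (suc n) (suc k) = n * stirling1 n (suc k) + stirling1 n k

sgn : ℕ → ℤ
sgn zero    = ℤ.+ 1
sgn (suc n) = ℤ.- sgn n

sumTo : ℕ → (ℕ → ℤ) → ℤ
sumTo zero    f = f 0
sumTo (suc n) f = sumTo n f ℤ.+ f (suc n)

{-# OPTIONS --safe #-}
-- Over ℤ, (X + 1)(X + 2) ⋯ (X + M) = Σₛ [M+1, s+1] Xˢ. The transform
-- Σⱼ (j choose s) aʲ pⱼ equals aˢ times the coefficient of Xˢ in p (X + a), and
-- substituting X - (M + 1) for X turns (X + 1) ⋯ (X + M) into (X - M) ⋯ (X - 1),
-- whose coefficients are those of (X + 1) ⋯ (X + M) with alternating signs.
-- Taking a = -(M + 1) gives the second identity; the first follows from it by
-- dropping the terms j < s, where the binomial vanishes, and cancelling (M + 1)ˢ.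
module Submission where

open import Defs

module StirlingIdentities where

  open import Data.Nat as ℕ using (ℕ; zero; suc; _<_; _≤_; _∸_; z≤n; s≤s)
  import Data.Nat.Properties as ℕₚ
  open import Data.Nat.Combinatorics using (_C_; nCk+nC[k+1]≡[n+1]C[k+1]; k>n⇒nCk≡0)
  open import Data.Integer using (ℤ; +_; -_; 0ℤ; 1ℤ; _+_; _*_; _^_)
  import Data.Integer.Properties as ℤₚ
  open import Algebra.Properties.CommutativeSemigroup ℤₚ.+-commutativeSemigroup
    using () renaming (interchange to +-interchange)
  open import Algebra.Properties.CommutativeSemigroup ℤₚ.*-commutativeSemigroup
    using (xy∙z≈y∙xz; x∙yz≈y∙xz)
  open import Data.Nat.Tactic.RingSolver using () renaming (solve-∀ to ℕ-solve-∀)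
  open import Data.Integer.Tactic.RingSolver using (solve-∀)
  open import Relation.Binary.PropositionalEquality
    using (_≡_; _≗_; refl; sym; trans; cong; cong₂; module ≡-Reasoning)
  open ≡-Reasoning

  sumTo-cong : ∀ n {f g : ℕ → ℤ} → (∀ {j} → j ≤ n → f j ≡ g j) → sumTo n f ≡ sumTo n g
  sumTo-cong zero    eq = eq z≤n
  sumTo-cong (suc n) eq =
    cong₂ _+_ (sumTo-cong n (λ j≤n → eq (ℕₚ.m≤n⇒m≤1+n j≤n))) (eq ℕₚ.≤-refl)

  sumTo-+ : ∀ n (f g : ℕ → ℤ) → sumTo n (λ j → f j + g j) ≡ sumTo n f + sumTo n g
  sumTo-+ zero    f g = refl
  sumTo-+ (suc n) f g =
    trans (cong (_+ (f (suc n) + g (suc n))) (sumTo-+ n f g))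
          (+-interchange (sumTo n f) (sumTo n g) (f (suc n)) (g (suc n)))

  sumTo-*ˡ : ∀ n c (f : ℕ → ℤ) → sumTo n (λ j → c * f j) ≡ c * sumTo n f
  sumTo-*ˡ zero    c f = refl
  sumTo-*ˡ (suc n) c f =
    trans (cong (_+ c * f (suc n)) (sumTo-*ˡ n c f)) (sym (ℤₚ.*-distribˡ-+ c _ _))

  sumTo-suc : ∀ n (f : ℕ → ℤ) → sumTo (suc n) f ≡ f 0 + sumTo n (λ j → f (suc j))
  sumTo-suc zero    f = refl
  sumTo-suc (suc n) f = trans (cong (_+ f (suc (suc n))) (sumTo-suc n f)) (ℤₚ.+-assoc (f 0) _ _)

  sumTo-dropZeros : ∀ k s (f : ℕ → ℤ) → (∀ {j} → j < s → f j ≡ 0ℤ) →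
                    sumTo (k ℕ.+ s) f ≡ sumTo k (λ r → f (r ℕ.+ s))
  sumTo-dropZeros k zero f _ =
    trans (cong (λ n → sumTo n f) (ℕₚ.+-identityʳ k))
          (sumTo-cong k (λ {r} _ → cong f (sym (ℕₚ.+-identityʳ r))))
  sumTo-dropZeros k (suc s) f zeros = begin
    sumTo (k ℕ.+ suc s) f                     ≡⟨ cong (λ n → sumTo n f) (ℕₚ.+-suc k s) ⟩
    sumTo (suc (k ℕ.+ s)) f                   ≡⟨ sumTo-suc (k ℕ.+ s) f ⟩
    f 0 + sumTo (k ℕ.+ s) (λ j → f (suc j))   ≡⟨ cong₂ _+_ (zeros (s≤s z≤n)) tail ⟩
    0ℤ + sumTo k (λ r → f (suc (r ℕ.+ s)))    ≡⟨ ℤₚ.+-identityˡ _ ⟩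
    sumTo k (λ r → f (suc (r ℕ.+ s)))         ≡⟨ sumTo-cong k (λ {r} _ → cong f (sym (ℕₚ.+-suc r s))) ⟩
    sumTo k (λ r → f (r ℕ.+ suc s))           ∎
    where
    tail = sumTo-dropZeros k s (λ j → f (suc j)) (λ j<s → zeros (s≤s j<s))

  sgn-+ : ∀ m n → sgn (m ℕ.+ n) ≡ sgn m * sgn n
  sgn-+ zero    n = sym (ℤₚ.*-identityˡ (sgn n))
  sgn-+ (suc m) n = trans (cong -_ (sgn-+ m n)) (ℤₚ.neg-distribˡ-* (sgn m) (sgn n))

  sgn*sgn≡1 : ∀ n → sgn n * sgn n ≡ 1ℤ
  sgn*sgn≡1 zero    = refl
  sgn*sgn≡1 (suc n) = trans (neg*neg (sgn n)) (sgn*sgn≡1 n)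
    where
    neg*neg : ∀ x → (- x) * (- x) ≡ x * x
    neg*neg = solve-∀

  sgn-*-cancelˡ : ∀ n {x y} → sgn n * x ≡ sgn n * y → x ≡ y
  sgn-*-cancelˡ n {x} {y} eq = begin
    x                       ≡⟨ sym (unsign x) ⟩
    sgn n * (sgn n * x)     ≡⟨ cong (sgn n *_) eq ⟩
    sgn n * (sgn n * y)     ≡⟨ unsign y ⟩
    y                       ∎
    where
    unsign : ∀ z → sgn n * (sgn n * z) ≡ z
    unsign z = trans (sym (ℤₚ.*-assoc (sgn n) (sgn n) z))
                     (trans (cong (_* z) (sgn*sgn≡1 n)) (ℤₚ.*-identityˡ z))

  sgn-∸ : ∀ {m n} → m ≤ n → sgn m ≡ sgn (n ∸ m) * sgn n
  sgn-∸ {m} {n} m≤n = begin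
    sgn m                               ≡⟨ sym (ℤₚ.*-identityˡ (sgn m)) ⟩
    1ℤ * sgn m                          ≡⟨ cong (_* sgn m) (sym (sgn*sgn≡1 (n ∸ m))) ⟩
    (sgn (n ∸ m) * sgn (n ∸ m)) * sgn m ≡⟨ ℤₚ.*-assoc (sgn (n ∸ m)) _ _ ⟩
    sgn (n ∸ m) * (sgn (n ∸ m) * sgn m) ≡⟨ cong (sgn (n ∸ m) *_) (sym (sgn-+ (n ∸ m) m)) ⟩
    sgn (n ∸ m) * sgn (n ∸ m ℕ.+ m)     ≡⟨ cong (λ k → sgn (n ∸ m) * sgn k) (ℕₚ.m∸n+n≡m m≤n) ⟩
    sgn (n ∸ m) * sgn n                 ∎

  [-n]^j≡sgn[j]*n^j : ∀ n j → (- + n) ^ j ≡ sgn j * + (n ℕ.^ j)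
  [-n]^j≡sgn[j]*n^j n zero    = refl
  [-n]^j≡sgn[j]*n^j n (suc j) = begin
    (- + n) * (- + n) ^ j           ≡⟨ cong ((- + n) *_) ([-n]^j≡sgn[j]*n^j n j) ⟩
    (- + n) * (sgn j * + (n ℕ.^ j)) ≡⟨ regroup (+ n) (sgn j) (+ (n ℕ.^ j)) ⟩
    (- sgn j) * (+ n * + (n ℕ.^ j)) ≡⟨ cong ((- sgn j) *_) (sym (ℤₚ.pos-* n (n ℕ.^ j))) ⟩
    (- sgn j) * + (n ℕ.* n ℕ.^ j)   ∎
    where
    regroup : ∀ x u y → (- x) * (u * y) ≡ (- u) * (x * y)
    regroup = solve-∀

  pos-*-* : ∀ x y z → + (x ℕ.* y ℕ.* z) ≡ + x * + y * + z
  pos-*-* x y z = trans (ℤₚ.pos-* (x ℕ.* y) z) (cong (_* + z) (ℤₚ.pos-* x y))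

  -- A polynomial over ℤ is represented by its coefficient sequence ℕ → ℤ.
  one : ℕ → ℤ
  one zero    = 1ℤ
  one (suc _) = 0ℤ

  timesX : (ℕ → ℤ) → ℕ → ℤ
  timesX f zero    = 0ℤ
  timesX f (suc s) = f s

  mulX+ : ℤ → (ℕ → ℤ) → ℕ → ℤ
  mulX+ b f s = b * f s + timesX f s

  timesX-cong : ∀ {f g} → f ≗ g → timesX f ≗ timesX g
  timesX-cong eq zero    = refl
  timesX-cong eq (suc s) = eq s

  mulX+-cong : ∀ b {f g} → f ≗ g → mulX+ b f ≗ mulX+ b g
  mulX+-cong b eq s = cong₂ (λ x y → b * x + y) (eq s) (timesX-cong eq s)

  mulX+-comm : ∀ b c f → mulX+ b (mulX+ c f) ≗ mulX+ c (mulX+ b f)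
  mulX+-comm b c f zero    = comm₀ b c (f 0)
    where
    comm₀ : ∀ b c x → b * (c * x + 0ℤ) + 0ℤ ≡ c * (b * x + 0ℤ) + 0ℤ
    comm₀ = solve-∀
  mulX+-comm b c f (suc s) = comm b c (f (suc s)) (f s) (timesX f s)
    where
    comm : ∀ b c x y z → b * (c * x + y) + (c * y + z) ≡ c * (b * x + y) + (b * y + z)
    comm = solve-∀

  mulX+-*ˡ : ∀ b c f s → mulX+ b (λ k → c * f k) s ≡ c * mulX+ b f s
  mulX+-*ˡ b c f zero    = scalar₀ b c (f 0)
    where
    scalar₀ : ∀ b c x → b * (c * x) + 0ℤ ≡ c * (b * x + 0ℤ)
    scalar₀ = solve-∀
  mulX+-*ˡ b c f (suc s) = scalar b c (f (suc s)) (f s)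
    where
    scalar : ∀ b c x y → b * (c * x) + c * y ≡ c * (b * x + y)
    scalar = solve-∀

  sgn-mulX+ : ∀ b f s → sgn s * mulX+ (- b) f s ≡ - mulX+ b (λ k → sgn k * f k) s
  sgn-mulX+ b f zero    = twist₀ b (f 0)
    where
    twist₀ : ∀ b x → 1ℤ * ((- b) * x + 0ℤ) ≡ - (b * (1ℤ * x) + 0ℤ)
    twist₀ = solve-∀
  sgn-mulX+ b f (suc s) = twist b (sgn s) (f (suc s)) (f s)
    where
    twist : ∀ b u x y → (- u) * ((- b) * x + y) ≡ - (b * ((- u) * x) + u * y)
    twist = solve-∀

  rising : ℕ → ℤ → ℕ → ℤ
  rising zero    a = one
  rising (suc n) a = mulX+ (a + + suc n) (rising n a)

  rising-suc : ∀ n a → rising (suc n) a ≗ mulX+ (a + 1ℤ) (rising n (a + 1ℤ))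
  rising-suc zero    a s = refl
  rising-suc (suc n) a s = begin
    mulX+ (a + + suc (suc n)) (rising (suc n) a) s
      ≡⟨ mulX+-cong (a + + suc (suc n)) (rising-suc n a) s ⟩
    mulX+ (a + + suc (suc n)) (mulX+ (a + 1ℤ) (rising n (a + 1ℤ))) s
      ≡⟨ mulX+-comm (a + + suc (suc n)) (a + 1ℤ) (rising n (a + 1ℤ)) s ⟩
    mulX+ (a + 1ℤ) (mulX+ (a + + suc (suc n)) (rising n (a + 1ℤ))) s
      ≡⟨ cong (λ b → mulX+ (a + 1ℤ) (mulX+ b (rising n (a + 1ℤ))) s) (sym (ℤₚ.+-assoc a 1ℤ (+ suc n))) ⟩
    mulX+ (a + 1ℤ) (rising (suc n) (a + 1ℤ)) s ∎

  rising-degree : ∀ n a {s} → n < s → rising n a s ≡ 0ℤ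
  rising-degree zero    a {suc s} _ = refl
  rising-degree (suc n) a {suc s} (s≤s n<s) = begin
    (a + + suc n) * rising n a (suc s) + rising n a s
      ≡⟨ cong₂ (λ x y → (a + + suc n) * x + y)
               (rising-degree n a (ℕₚ.m<n⇒m<1+n n<s)) (rising-degree n a n<s) ⟩
    (a + + suc n) * 0ℤ + 0ℤ
      ≡⟨ trans (ℤₚ.+-identityʳ _) (ℤₚ.*-zeroʳ (a + + suc n)) ⟩
    0ℤ ∎

  rising-stirling1 : ∀ n s → rising n 0ℤ s ≡ + stirling1 (suc n) (suc s)
  rising-stirling1 zero    zero    = refl
  rising-stirling1 zero    (suc s) = refl
  rising-stirling1 (suc n) s = begin
    + suc n * rising n 0ℤ s + timesX (rising n 0ℤ) s
      ≡⟨ cong₂ (λ x y → + suc n * x + y) (rising-stirling1 n s) (lowered s) ⟩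
    + suc n * + stirling1 (suc n) (suc s) + + stirling1 (suc n) s
      ≡⟨ cong (_+ + stirling1 (suc n) s) (sym (ℤₚ.pos-* (suc n) _)) ⟩
    + (suc n ℕ.* stirling1 (suc n) (suc s)) + + stirling1 (suc n) s
      ≡⟨ sym (ℤₚ.pos-+ (suc n ℕ.* stirling1 (suc n) (suc s)) _) ⟩
    + stirling1 (suc (suc n)) (suc s) ∎
    where
    lowered : ∀ s → timesX (rising n 0ℤ) s ≡ + stirling1 (suc n) s
    lowered zero    = refl
    lowered (suc s) = rising-stirling1 n s

  rising-stirling1′ : ∀ n j → rising n 0ℤ j ≡ + stirling1 (suc n) (j ℕ.+ 1)
  rising-stirling1′ n j = 
    trans (rising-stirling1 n j) (cong (λ k → + stirling1 (suc n) k) (ℕₚ.+-comm 1 j))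

  rising-reflect : ∀ n a s → sgn s * rising n (- (a + + suc n)) s ≡ sgn n * rising n a s
  rising-reflect zero    a zero    = refl
  rising-reflect zero    a (suc s) = ℤₚ.*-zeroʳ (sgn (suc s))
  rising-reflect (suc n) a s = begin
    sgn s * mulX+ (b + + suc n) (rising n b) s
      ≡⟨ cong₂ (λ c d → sgn s * mulX+ c (rising n d) s)
               (shift a (+ suc n)) (cong -_ (sym (ℤₚ.+-assoc a 1ℤ (+ suc n)))) ⟩
    sgn s * mulX+ (- (a + 1ℤ)) (rising n (- ((a + 1ℤ) + + suc n))) s
      ≡⟨ sgn-mulX+ (a + 1ℤ) (rising n (- ((a + 1ℤ) + + suc n))) s ⟩
    - mulX+ (a + 1ℤ) (λ k → sgn k * rising n (- ((a + 1ℤ) + + suc n)) k) s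
      ≡⟨ cong -_ (mulX+-cong (a + 1ℤ) (rising-reflect n (a + 1ℤ)) s) ⟩
    - mulX+ (a + 1ℤ) (λ k → sgn n * rising n (a + 1ℤ) k) s
      ≡⟨ cong -_ (mulX+-*ˡ (a + 1ℤ) (sgn n) (rising n (a + 1ℤ)) s) ⟩
    - (sgn n * mulX+ (a + 1ℤ) (rising n (a + 1ℤ)) s)
      ≡⟨ ℤₚ.neg-distribˡ-* (sgn n) _ ⟩
    - sgn n * mulX+ (a + 1ℤ) (rising n (a + 1ℤ)) s
      ≡⟨ cong (- sgn n *_) (sym (rising-suc n a s)) ⟩
    - sgn n * rising (suc n) a s ∎
    where
    b = - (a + + suc (suc n))
    shift : ∀ a m → - (a + (1ℤ + m)) + m ≡ - (a + 1ℤ)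
    shift = solve-∀

  -- For p of degree at most n, taylor a n p s is aˢ times the coefficient of Xˢ in p (X + a).
  taylor : ℤ → ℕ → (ℕ → ℤ) → ℕ → ℤ
  taylor a n p s = sumTo n (λ j → + (j C s) * a ^ j * p j)

  dilate : ℤ → (ℕ → ℤ) → ℕ → ℤ
  dilate a f s = a ^ s * f s

  mulAX+ : ℤ → ℤ → (ℕ → ℤ) → ℕ → ℤ
  mulAX+ a c f s = c * f s + a * timesX f s

  mulAX+-cong : ∀ a c {f g} → f ≗ g → mulAX+ a c f ≗ mulAX+ a c g
  mulAX+-cong a c eq s = cong₂ (λ x y → c * x + a * y) (eq s) (timesX-cong eq s)

  dilate-mulX+ : ∀ a c f → dilate a (mulX+ c f) ≗ mulAX+ a c (dilate a f)
  dilate-mulX+ a c f zero    = dilate₀ a c (f 0)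
    where
    dilate₀ : ∀ a c x → 1ℤ * (c * x + 0ℤ) ≡ c * (1ℤ * x) + a * 0ℤ
    dilate₀ = solve-∀
  dilate-mulX+ a c f (suc s) = dilateₛ a c (a ^ s) (f (suc s)) (f s)
    where
    dilateₛ : ∀ a c u x y → (a * u) * (c * x + y) ≡ c * ((a * u) * x) + a * (u * y)
    dilateₛ = solve-∀

  taylor-linear : ∀ a n b p q s →
                  taylor a n (λ j → b * p j + q j) s ≡ b * taylor a n p s + taylor a n q s
  taylor-linear a n b p q s = begin
    sumTo n (λ j → w j * (b * p j + q j))
      ≡⟨ sumTo-cong n (λ {j} _ → distrib (w j) b (p j) (q j)) ⟩
    sumTo n (λ j → b * (w j * p j) + w j * q j)
      ≡⟨ sumTo-+ n _ _ ⟩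
    sumTo n (λ j → b * (w j * p j)) + taylor a n q s
      ≡⟨ cong (_+ taylor a n q s) (sumTo-*ˡ n b _) ⟩
    b * taylor a n p s + taylor a n q s ∎
    where
    w : ℕ → ℤ
    w j = + (j C s) * a ^ j
    distrib : ∀ w b x y → w * (b * x + y) ≡ b * (w * x) + w * y
    distrib = solve-∀

  taylor-suc : ∀ a n p s → p (suc n) ≡ 0ℤ → taylor a (suc n) p s ≡ taylor a n p s
  taylor-suc a n p s p[n+1]≡0 = begin
    taylor a n p s + + (suc n C s) * a ^ suc n * p (suc n)
      ≡⟨ cong (λ x → taylor a n p s + + (suc n C s) * a ^ suc n * x) p[n+1]≡0 ⟩
    taylor a n p s + + (suc n C s) * a ^ suc n * 0ℤ
      ≡⟨ cong (λ x → taylor a n p s + x) (ℤₚ.*-zeroʳ (+ (suc n C s) * a ^ suc n)) ⟩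
    taylor a n p s + 0ℤ
      ≡⟨ ℤₚ.+-identityʳ _ ⟩
    taylor a n p s ∎

  taylor-pascal : ∀ a n p s →
    sumTo n (λ j → + (suc j C s) * a ^ suc j * p j) ≡ mulAX+ a a (taylor a n p) s
  taylor-pascal a n p zero = begin
    sumTo n (λ j → 1ℤ * a ^ suc j * p j)         ≡⟨ sumTo-cong n (λ {j} _ → pull a (a ^ j) (p j)) ⟩
    sumTo n (λ j → a * (1ℤ * a ^ j * p j))       ≡⟨ sumTo-*ˡ n a _ ⟩
    a * taylor a n p 0                           ≡⟨ pad a (taylor a n p 0) ⟩
    a * taylor a n p 0 + a * 0ℤ                  ∎
    where
    pull : ∀ a u x → 1ℤ * (a * u) * x ≡ a * (1ℤ * u * x)
    pull = solve-∀
    pad : ∀ a x → a * x ≡ a * x + a * 0ℤ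
    pad = solve-∀
  taylor-pascal a n p (suc s) = begin
    sumTo n (λ j → + (suc j C suc s) * a ^ suc j * p j)
      ≡⟨ sumTo-cong n (λ {j} _ → split j) ⟩
    sumTo n (λ j → a * (+ (j C suc s) * a ^ j * p j) + a * (+ (j C s) * a ^ j * p j))
      ≡⟨ sumTo-+ n _ _ ⟩
    sumTo n (λ j → a * (+ (j C suc s) * a ^ j * p j)) + sumTo n (λ j → a * (+ (j C s) * a ^ j * p j))
      ≡⟨ cong₂ _+_ (sumTo-*ˡ n a _) (sumTo-*ˡ n a _) ⟩
    a * taylor a n p (suc s) + a * taylor a n p s ∎
    where
    distrib : ∀ a c d u x → (c + d) * (a * u) * x ≡ a * (d * u * x) + a * (c * u * x)
    distrib = solve-∀
    split : ∀ j → + (suc j C suc s) * a ^ suc j * p j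
                ≡ a * (+ (j C suc s) * a ^ j * p j) + a * (+ (j C s) * a ^ j * p j)
    split j = begin
      + (suc j C suc s) * a ^ suc j * p j
        ≡⟨ cong (λ c → + c * a ^ suc j * p j) (sym (nCk+nC[k+1]≡[n+1]C[k+1] j s)) ⟩
      + (j C s ℕ.+ j C suc s) * a ^ suc j * p j
        ≡⟨ cong (λ c → c * a ^ suc j * p j) (ℤₚ.pos-+ (j C s) (j C suc s)) ⟩
      (+ (j C s) + + (j C suc s)) * (a * a ^ j) * p j
        ≡⟨ distrib a (+ (j C s)) (+ (j C suc s)) (a ^ j) (p j) ⟩
      a * (+ (j C suc s) * a ^ j * p j) + a * (+ (j C s) * a ^ j * p j) ∎

  taylor-timesX : ∀ a n p → taylor a (suc n) (timesX p) ≗ mulAX+ a a (taylor a n p)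
  taylor-timesX a n p s = begin
    taylor a (suc n) (timesX p) s                      ≡⟨ sumTo-suc n _ ⟩
    + (0 C s) * 1ℤ * 0ℤ + shifted                      ≡⟨ cong (_+ shifted) (ℤₚ.*-zeroʳ (+ (0 C s) * 1ℤ)) ⟩
    0ℤ + shifted                                       ≡⟨ ℤₚ.+-identityˡ shifted ⟩
    shifted                                            ≡⟨ taylor-pascal a n p s ⟩
    mulAX+ a a (taylor a n p) s                        ∎
    where
    shifted = sumTo n (λ j → + (suc j C s) * a ^ suc j * p j)

  taylor-mulX+ : ∀ a n b p → p (suc n) ≡ 0ℤ →
                 taylor a (suc n) (mulX+ b p) ≗ mulAX+ a (a + b) (taylor a n p)
  taylor-mulX+ a n b p p[n+1]≡0 s = begin
    taylor a (suc n) (mulX+ b p) s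
      ≡⟨ taylor-linear a (suc n) b p (timesX p) s ⟩
    b * taylor a (suc n) p s + taylor a (suc n) (timesX p) s
      ≡⟨ cong₂ (λ x y → b * x + y) (taylor-suc a n p s p[n+1]≡0) (taylor-timesX a n p s) ⟩
    b * T s + (a * T s + a * timesX T s)
      ≡⟨ collect a b (T s) (timesX T s) ⟩
    (a + b) * T s + a * timesX T s ∎
    where
    T = taylor a n p
    collect : ∀ a b x y → b * x + (a * x + a * y) ≡ (a + b) * x + a * y
    collect = solve-∀

  taylor-rising : ∀ n c a → taylor a n (rising n c) ≗ dilate a (rising n (c + a))
  taylor-rising zero    c a zero    = refl
  taylor-rising zero    c a (suc s) = sym (ℤₚ.*-zeroʳ (a ^ suc s))
  taylor-rising (suc n) c a s = begin
    taylor a (suc n) (mulX+ (c + + suc n) (rising n c)) s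
      ≡⟨ taylor-mulX+ a n (c + + suc n) (rising n c) (rising-degree n c (ℕₚ.n<1+n n)) s ⟩
    mulAX+ a (a + (c + + suc n)) (taylor a n (rising n c)) s
      ≡⟨ mulAX+-cong a (a + (c + + suc n)) (taylor-rising n c a) s ⟩
    mulAX+ a (a + (c + + suc n)) (dilate a (rising n (c + a))) s
      ≡⟨ cong (λ b → mulAX+ a b (dilate a (rising n (c + a))) s) (reassoc a c (+ suc n)) ⟩
    mulAX+ a ((c + a) + + suc n) (dilate a (rising n (c + a))) s
      ≡⟨ sym (dilate-mulX+ a ((c + a) + + suc n) (rising n (c + a)) s) ⟩
    dilate a (rising (suc n) (c + a)) s ∎
    where
    reassoc : ∀ a c m → a + (c + m) ≡ (c + a) + m
    reassoc = solve-∀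

  alternatingTerm : ℕ → ℕ → ℕ → ℤ
  alternatingTerm M s j = sgn j * + (suc M ℕ.^ j ℕ.* (j C s) ℕ.* stirling1 (suc M) (j ℕ.+ 1))

  truncatedTerm : ℕ → ℕ → ℕ → ℤ
  truncatedTerm M s r =
    sgn ((M ∸ s) ∸ r) * + (suc M ℕ.^ r ℕ.* ((r ℕ.+ s) C s) ℕ.* stirling1 (suc M) (r ℕ.+ s ℕ.+ 1))

  alternatingTerm-taylor : ∀ M s j → alternatingTerm M s j ≡ + (j C s) * (- + suc M) ^ j * rising M 0ℤ j
  alternatingTerm-taylor M s j = begin
    sgn j * + (N ℕ.^ j ℕ.* (j C s) ℕ.* stirling1 N (j ℕ.+ 1))
      ≡⟨ cong (sgn j *_) (pos-*-* (N ℕ.^ j) (j C s) (stirling1 N (j ℕ.+ 1))) ⟩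
    sgn j * (+ (N ℕ.^ j) * + (j C s) * + stirling1 N (j ℕ.+ 1))
      ≡⟨ rearrange (sgn j) (+ (N ℕ.^ j)) (+ (j C s)) (+ stirling1 N (j ℕ.+ 1)) ⟩
    + (j C s) * (sgn j * + (N ℕ.^ j)) * + stirling1 N (j ℕ.+ 1)
      ≡⟨ cong₂ (λ x y → + (j C s) * x * y) (sym ([-n]^j≡sgn[j]*n^j N j)) (sym (rising-stirling1′ M j)) ⟩
    + (j C s) * (- + N) ^ j * rising M 0ℤ j ∎
    where
    N = suc M
    rearrange : ∀ u x c y → u * (x * c * y) ≡ c * (u * x) * y
    rearrange = solve-∀

  alternating-identity : ∀ M s →
    sumTo M (alternatingTerm M s) ≡ sgn M * + (suc M ℕ.^ s ℕ.* stirling1 (suc M) (s ℕ.+ 1))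
  alternating-identity M s = begin
    sumTo M (alternatingTerm M s)
      ≡⟨ sumTo-cong M (λ {j} _ → alternatingTerm-taylor M s j) ⟩
    taylor (- + N) M (rising M 0ℤ) s
      ≡⟨ taylor-rising M 0ℤ (- + N) s ⟩
    (- + N) ^ s * rising M (0ℤ + - + N) s
      ≡⟨ cong₂ (λ x a → x * rising M a s) ([-n]^j≡sgn[j]*n^j N s) (ℤₚ.+-identityˡ (- + N)) ⟩
    sgn s * + (N ℕ.^ s) * rising M (- + N) s
      ≡⟨ xy∙z≈y∙xz (sgn s) (+ (N ℕ.^ s)) (rising M (- + N) s) ⟩
    + (N ℕ.^ s) * (sgn s * rising M (- + N) s)
      ≡⟨ cong (+ (N ℕ.^ s) *_) (rising-reflect M 0ℤ s) ⟩
    + (N ℕ.^ s) * (sgn M * rising M 0ℤ s)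
      ≡⟨ cong (λ x → + (N ℕ.^ s) * (sgn M * x)) (rising-stirling1′ M s) ⟩
    + (N ℕ.^ s) * (sgn M * + stirling1 N (s ℕ.+ 1))
      ≡⟨ x∙yz≈y∙xz (+ (N ℕ.^ s)) (sgn M) (+ stirling1 N (s ℕ.+ 1)) ⟩
    sgn M * (+ (N ℕ.^ s) * + stirling1 N (s ℕ.+ 1))
      ≡⟨ cong (sgn M *_) (sym (ℤₚ.pos-* (N ℕ.^ s) (stirling1 N (s ℕ.+ 1)))) ⟩
    sgn M * + (N ℕ.^ s ℕ.* stirling1 N (s ℕ.+ 1)) ∎
    where
    N = suc M

  alternatingTerm-below : ∀ M {s j} → j < s → alternatingTerm M s j ≡ 0ℤ
  alternatingTerm-below M {s} {j} j<s = begin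
    sgn j * + (N ℕ.^ j ℕ.* (j C s) ℕ.* stirling1 N (j ℕ.+ 1))
      ≡⟨ cong (λ c → sgn j * + (N ℕ.^ j ℕ.* c ℕ.* stirling1 N (j ℕ.+ 1))) (k>n⇒nCk≡0 j<s) ⟩
    sgn j * + (N ℕ.^ j ℕ.* 0 ℕ.* stirling1 N (j ℕ.+ 1))
      ≡⟨ cong (λ c → sgn j * + (c ℕ.* stirling1 N (j ℕ.+ 1))) (ℕₚ.*-zeroʳ (N ℕ.^ j)) ⟩
    sgn j * 0ℤ
      ≡⟨ ℤₚ.*-zeroʳ (sgn j) ⟩
    0ℤ ∎
    where
    N = suc M

  alternatingTerm-shift : ∀ {M s r} → s ≤ M → r ≤ M ∸ s →
                          alternatingTerm M s (r ℕ.+ s) ≡ sgn M * (+ (suc M ℕ.^ s) * truncatedTerm M s r)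
  alternatingTerm-shift {M} {s} {r} s≤M r≤M∸s = begin
    sgn (r ℕ.+ s) * + (N ℕ.^ (r ℕ.+ s) ℕ.* b ℕ.* c)
      ≡⟨ cong₂ _*_ sign power ⟩
    sgn (M ∸ s ∸ r) * sgn M * (+ (N ℕ.^ s) * + (N ℕ.^ r ℕ.* b ℕ.* c))
      ≡⟨ regroup (sgn (M ∸ s ∸ r)) (sgn M) (+ (N ℕ.^ s)) (+ (N ℕ.^ r ℕ.* b ℕ.* c)) ⟩
    sgn M * (+ (N ℕ.^ s) * truncatedTerm M s r) ∎
    where
    N = suc M
    b = (r ℕ.+ s) C s
    c = stirling1 N (r ℕ.+ s ℕ.+ 1)
    r+s≤M : r ℕ.+ s ≤ M
    r+s≤M = ℕₚ.≤-trans (ℕₚ.+-monoˡ-≤ s r≤M∸s) (ℕₚ.≤-reflexive (ℕₚ.m∸n+n≡m s≤M))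
    M∸[r+s]≡M∸s∸r : M ∸ (r ℕ.+ s) ≡ M ∸ s ∸ r
    M∸[r+s]≡M∸s∸r = trans (cong (M ∸_) (ℕₚ.+-comm r s)) (sym (ℕₚ.∸-+-assoc M s r))
    sign : sgn (r ℕ.+ s) ≡ sgn (M ∸ s ∸ r) * sgn M
    sign = trans (sgn-∸ r+s≤M) (cong (λ d → sgn d * sgn M) M∸[r+s]≡M∸s∸r)
    reorder : ∀ w x y z → w ℕ.* x ℕ.* y ℕ.* z ≡ x ℕ.* (w ℕ.* y ℕ.* z)
    reorder = ℕ-solve-∀
    power : + (N ℕ.^ (r ℕ.+ s) ℕ.* b ℕ.* c) ≡ + (N ℕ.^ s) * + (N ℕ.^ r ℕ.* b ℕ.* c)
    power = begin
      + (N ℕ.^ (r ℕ.+ s) ℕ.* b ℕ.* c)       ≡⟨ cong (λ x → + (x ℕ.* b ℕ.* c)) (ℕₚ.^-distribˡ-+-* N r s) ⟩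
      + (N ℕ.^ r ℕ.* N ℕ.^ s ℕ.* b ℕ.* c)   ≡⟨ cong +_ (reorder (N ℕ.^ r) (N ℕ.^ s) b c) ⟩
      + (N ℕ.^ s ℕ.* (N ℕ.^ r ℕ.* b ℕ.* c)) ≡⟨ ℤₚ.pos-* (N ℕ.^ s) _ ⟩
      + (N ℕ.^ s) * + (N ℕ.^ r ℕ.* b ℕ.* c) ∎
    regroup : ∀ u v x y → u * v * (x * y) ≡ v * (x * (u * y))
    regroup = solve-∀

  truncated-identity : ∀ M s → s ≤ M → sumTo (M ∸ s) (truncatedTerm M s) ≡ + stirling1 (suc M) (s ℕ.+ 1)
  truncated-identity M s s≤M =
    ℤₚ.*-cancelˡ-≡ (+ (N ℕ.^ s)) T (+ stirling1 N (s ℕ.+ 1)) {{ℕₚ.m^n≢0 N s}} (sgn-*-cancelˡ M (begin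
      sgn M * (+ (N ℕ.^ s) * T)
        ≡⟨ cong (sgn M *_) (sumTo-*ˡ k (+ (N ℕ.^ s)) (truncatedTerm M s)) ⟨
      sgn M * sumTo k (λ r → + (N ℕ.^ s) * truncatedTerm M s r)
        ≡⟨ sumTo-*ˡ k (sgn M) _ ⟨
      sumTo k (λ r → sgn M * (+ (N ℕ.^ s) * truncatedTerm M s r))
        ≡⟨ sumTo-cong k (alternatingTerm-shift s≤M) ⟨
      sumTo k (λ r → alternatingTerm M s (r ℕ.+ s))
        ≡⟨ sumTo-dropZeros k s (alternatingTerm M s) (alternatingTerm-below M) ⟨
      sumTo (k ℕ.+ s) (alternatingTerm M s)
        ≡⟨ cong (λ n → sumTo n (alternatingTerm M s)) (ℕₚ.m∸n+n≡m s≤M) ⟩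
      sumTo M (alternatingTerm M s)
        ≡⟨ alternating-identity M s ⟩
      sgn M * + (N ℕ.^ s ℕ.* stirling1 N (s ℕ.+ 1))
        ≡⟨ cong (sgn M *_) (ℤₚ.pos-* (N ℕ.^ s) _) ⟩
      sgn M * (+ (N ℕ.^ s) * + stirling1 N (s ℕ.+ 1)) ∎))
    where
    N = suc M
    k = M ∸ s
    T = sumTo k (truncatedTerm M s)

open StirlingIdentities using (truncated-identity; alternating-identity)
open import Data.Nat using (ℕ; _≤_; _∸_; _^_; _+_) renaming (_*_ to _*ℕ_)
open import Data.Nat.Combinatorics using (_C_)
open import Data.Integer as ℤ using (ℤ)
open import Data.Product using (_×_; _,_)
open import Relation.Binary.PropositionalEquality using (_≡_)
open import Data.Nat.Properties using (+-comm)

corollary2 : (M s : ℕ) → 1 ≤ M → s ≤ M →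
  (sumTo (M ∸ s) (λ r → sgn ((M ∸ s) ∸ r) ℤ.* ℤ.+ (((M + 1) ^ r) *ℕ ((r + s) C s) *ℕ stirling1 ((M + 1)) (r + s + 1)))
    ≡ ℤ.+ stirling1 ((M + 1)) (s + 1))
  × (sumTo M (λ j → sgn j ℤ.* ℤ.+ (((M + 1) ^ j) *ℕ (j C s) *ℕ stirling1 ((M + 1)) (j + 1)))
    ≡ sgn M ℤ.* ℤ.+ (((M + 1) ^ s) *ℕ stirling1 ((M + 1)) (s + 1)))
corollary2 M s _ s≤M rewrite +-comm M 1 = truncated-identity M s s≤M , alternating-identity M s
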